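{- Let $v\geq 1$ and, for $i=1,\dots,v$, let $A_i=\begin{bmatrix}0&\epsilon_i\\ 1&\alpha_i\end{bmatrix}$ with $\epsilon_i\in\{ -1,1\}$, $\alpha_i\in\mathbb{Z}$. Let $P_1,P_2$ be finite words in the letters $A_1,\dots,A_v$ satisfying the conditions in the context, with $P_1$ equal to an initial segment (prefix) of $P_2$. Let $(q_m)_{m\ge1}$ be positive integers, define $P_{m+2}=P_{m+1}^{q_m}P_m$ for $m\ge 1$, let $k_m$ be the length of $P_m$, and let $Q_n$ be the product of the first $n$ letters of $P_m$ for any $m$ with $k_m\ge n$. Then for every $n\in\mathbb{N}$ there exist an integer $l\ge0$, integers $2\le m_1<m_2<\dots<m_l$ and $n_1,\dots,n_l\in\mathbb{N}$ such that: (1) $n_i\le q_{m_i-1}$ for all $1\le i\le l$; (2) for all $2\le i\le l$, if $n_i=q_{m_i-1}$ then $m_{i-1}+2\le m_i$; (3) $Q_n=(P_{m_l})^{n_l}(P_{m_{l-1}})^{n_{l-1}}\cdots(P_{m_1})^{n_1}M_n$, where $M_n$ is the product of the letters of some initial segment (possibly empty) of the word $P_2$.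
   Context: Conditions on $P_1,P_2$: writing $P_i=\begin{bmatrix}a_i&b_i\\ c_i&d_i\end{bmatrix}$ for the matrix product of the word, $|d_i|\ge2$, $b_i\ne0$, $c_i\ne0$ and $0\le\frac{|a_i|}{|b_i|},\frac{|c_i|}{|d_i|},\frac{|a_i|}{|c_i|},\frac{|b_i|}{|d_i|}\le1$ for $i=1,2$. The assumption that $P_1$ is a prefix of $P_2$ is a standing assumption the paper makes for the rest of the paper; with it, the first $n$ letters of $P_m$ agree for all $m$ with $k_m\ge n$, so $Q_n$ is well defined. -}

module Defs where

open import Data.Nat as ℕ using (ℕ; zero; suc; _∸_)
open import Data.Integer using (ℤ; _+_; _*_; ∣_∣; +_; 0ℤ; 1ℤ; -1ℤ)
open import Data.Fin using (Fin)
open import Data.List using (List; []; _∷_; _++_; foldr)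
open import Data.Product using (_×_; _,_)
open import Relation.Binary.PropositionalEquality using (_≡_)
open import Relation.Nullary using (¬_)

record Mat : Set where
  constructor mat
  field
    a b c d : ℤ

open Mat public

infixl 7 _⊗_
_⊗_ : Mat → Mat → Mat
mat a₁ b₁ c₁ d₁ ⊗ mat a₂ b₂ c₂ d₂ =
  mat (a₁ * a₂ + b₁ * c₂) (a₁ * b₂ + b₁ * d₂)
      (c₁ * a₂ + d₁ * c₂) (c₁ * b₂ + d₁ * d₂)

I₂ : Mat
I₂ = mat 1ℤ 0ℤ 0ℤ 1ℤ

pow : Mat → ℕ → Mat
pow M zero    = I₂
pow M (suc n) = M ⊗ pow M n

letter : {v : ℕ} → (Fin v → ℤ) → (Fin v → ℤ) → Fin v → Mat
letter ε α i = mat 0ℤ (ε i) 1ℤ (α i)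

evalW : {v : ℕ} → (Fin v → ℤ) → (Fin v → ℤ) → List (Fin v) → Mat
evalW ε α = foldr (λ x acc → letter ε α x ⊗ acc) I₂

repW : {A : Set} → ℕ → List A → List A
repW zero    w = []
repW (suc n) w = w ++ repW n w

-- the sequence P_m (index 0 is unused and set to the empty word):
-- P_1 = p1, P_2 = p2, P_{m+2} = P_{m+1}^{q_m} P_m  (m ≥ 1)
Pw : {A : Set} → List A → List A → (ℕ → ℕ) → ℕ → List A
Pw p1 p2 q zero = []
Pw p1 p2 q (suc zero) = p1
Pw p1 p2 q (suc (suc zero)) = p2
Pw p1 p2 q (suc (suc (suc k))) =
  repW (q (suc k)) (Pw p1 p2 q (suc (suc k))) ++ Pw p1 p2 q (suc k)

-- the conditions on P_1, P_2 from the paper (ratios rewritten as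
-- inequalities of absolute values; denominators are nonzero)
Cond : Mat → Set
Cond (mat a b c d) =
  2 ℕ.≤ ∣ d ∣ × ¬ (b ≡ 0ℤ) × ¬ (c ≡ 0ℤ) ×
  ∣ a ∣ ℕ.≤ ∣ b ∣ × ∣ c ∣ ℕ.≤ ∣ d ∣ × ∣ a ∣ ℕ.≤ ∣ c ∣ × ∣ b ∣ ℕ.≤ ∣ d ∣

blocksProd : (ℕ → Mat) → List (ℕ × ℕ) → Mat
blocksProd PM = foldr (λ { (m , n) acc → acc ⊗ pow (PM m) n }) I₂

-- Since P_{m+2} = P_{m+1}^{q_m} P_m, a prefix of P_{m+2} either stops inside one of the
-- q_m copies of P_{m+1}, and is P_{m+1}^r w with r < q_m and w a prefix of P_{m+1}, or it
-- is P_{m+1}^{q_m} u with u a prefix of P_m. Recursing on w or u, the exponent q_m occurs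
-- only when the index drops by two, which is condition (2); the recursion ends in a prefix
-- of P_1 or P_2, hence of P_2. Evaluating words is a monoid homomorphism into 2×2
-- matrices, which turns this decomposition of words into the matrix identity.
module Submission where

open import Defs
open import Data.Nat using (ℕ; _≤_; _<_; _+_; _∸_)
open import Data.Integer using (ℤ; 1ℤ; -1ℤ)
open import Data.Fin using (Fin)
open import Data.List using (List; _++_; take; length)
open import Data.List.Relation.Unary.All using (All)
open import Data.List.Relation.Unary.Linked using (Linked)
open import Data.Product using (Σ; ∃; ∃-syntax; _×_; _,_)
open import Data.Sum using (_⊎_)
open import Relation.Binary.PropositionalEquality using (_≡_)

open import Data.Nat using (zero; suc; z≤n; s≤s)
open import Data.Nat.Properties using (<-irrefl; <-≤-trans; <⇒≤; m<n⇒m<1+n; n<1+n; n≤1+n; ≤-refl; +-comm)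
import Data.Integer as ℤ
open import Data.Integer.Tactic.RingSolver using (solve-∀)
open import Data.List using ([]; _∷_; foldr; drop)
open import Data.List.Properties using (++-assoc; ++-identityʳ; take++drop≡id)
open import Data.List.Relation.Unary.All using ([]; _∷_)
import Data.List.Relation.Unary.All as All
import Data.List.Relation.Unary.All.Properties as All
open import Data.List.Relation.Unary.Linked using ([]; [-]; _∷_)
open import Data.List.Relation.Binary.Prefix.Heterogeneous using (Prefix; []; _∷_)
open import Data.List.Relation.Binary.Prefix.Heterogeneous.Properties as Prefix using (length-mono)
open import Data.List.Relation.Binary.Prefix.Propositional.Properties using (∣ˡ-as-Prefix)
open import Data.Sum using (inj₁; inj₂)
open import Data.Empty using (⊥-elim)
open import Relation.Binary.PropositionalEquality as ≡ using (refl; sym; cong; cong₂; module ≡-Reasoning)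

private
  row-assoc : ∀ x₁ x₂ y₁ y₂ y₃ y₄ z₁ z₃ →
    (x₁ ℤ.* y₁ ℤ.+ x₂ ℤ.* y₃) ℤ.* z₁ ℤ.+ (x₁ ℤ.* y₂ ℤ.+ x₂ ℤ.* y₄) ℤ.* z₃
      ≡ x₁ ℤ.* (y₁ ℤ.* z₁ ℤ.+ y₂ ℤ.* z₃) ℤ.+ x₂ ℤ.* (y₃ ℤ.* z₁ ℤ.+ y₄ ℤ.* z₃)
  row-assoc = solve-∀

  one-zero-row : ∀ x y → 1ℤ ℤ.* x ℤ.+ ℤ.0ℤ ℤ.* y ≡ x
  one-zero-row = solve-∀

  zero-one-row : ∀ x y → ℤ.0ℤ ℤ.* x ℤ.+ 1ℤ ℤ.* y ≡ y
  zero-one-row = solve-∀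

⊗-assoc : ∀ X Y Z → (X ⊗ Y) ⊗ Z ≡ X ⊗ (Y ⊗ Z)
⊗-assoc (mat x₁ x₂ x₃ x₄) (mat y₁ y₂ y₃ y₄) (mat z₁ z₂ z₃ z₄)
  rewrite row-assoc x₁ x₂ y₁ y₂ y₃ y₄ z₁ z₃ | row-assoc x₁ x₂ y₁ y₂ y₃ y₄ z₂ z₄
        | row-assoc x₃ x₄ y₁ y₂ y₃ y₄ z₁ z₃ | row-assoc x₃ x₄ y₁ y₂ y₃ y₄ z₂ z₄ = refl

⊗-identityˡ : ∀ X → I₂ ⊗ X ≡ X
⊗-identityˡ (mat a b c d)
  rewrite one-zero-row a c | one-zero-row b d | zero-one-row a c | zero-one-row b d = refl

module _ {v : ℕ} (ε α : Fin v → ℤ) where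

  evalW-++ : ∀ xs ys → evalW ε α (xs ++ ys) ≡ evalW ε α xs ⊗ evalW ε α ys
  evalW-++ []       ys = sym (⊗-identityˡ (evalW ε α ys))
  evalW-++ (x ∷ xs) ys = begin
    letter ε α x ⊗ evalW ε α (xs ++ ys)                 ≡⟨ cong (letter ε α x ⊗_) (evalW-++ xs ys) ⟩
    letter ε α x ⊗ (evalW ε α xs ⊗ evalW ε α ys)        ≡⟨ sym (⊗-assoc (letter ε α x) (evalW ε α xs) (evalW ε α ys)) ⟩
    letter ε α x ⊗ evalW ε α xs ⊗ evalW ε α ys          ∎
    where open ≡-Reasoning

  evalW-repW : ∀ n w → evalW ε α (repW n w) ≡ pow (evalW ε α w) n
  evalW-repW zero    w = refl
  evalW-repW (suc n) w =
    ≡.trans (evalW-++ w (repW n w)) (cong (evalW ε α w ⊗_) (evalW-repW n w))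

infix 4 _⊑_
_⊑_ : {A : Set} → List A → List A → Set
_⊑_ = Prefix _≡_

⊑-trans : {A : Set} {xs ys zs : List A} → xs ⊑ ys → ys ⊑ zs → xs ⊑ zs
⊑-trans = Prefix.trans ≡.trans

take-⊑ : {A : Set} (n : ℕ) (xs : List A) → take n xs ⊑ xs
take-⊑ n xs = ∣ˡ-as-Prefix record { quotient = drop n xs ; equality = take++drop≡id n xs }

⊑⇒≡take : {A : Set} {xs ys : List A} → xs ⊑ ys → xs ≡ take (length xs) ys
⊑⇒≡take []         = refl
⊑⇒≡take (refl ∷ p) = cong (_ ∷_) (⊑⇒≡take p)

⊑-++ : {A : Set} (xs : List A) {ys zs : List A} → zs ⊑ xs ++ ys →
       zs ⊑ xs ⊎ ∃[ zs′ ] zs′ ⊑ ys × zs ≡ xs ++ zs′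
⊑-++ []       p          = inj₂ (_ , p , refl)
⊑-++ (x ∷ xs) []         = inj₁ []
⊑-++ (x ∷ xs) (refl ∷ p) with ⊑-++ xs p
... | inj₁ q              = inj₁ (refl ∷ q)
... | inj₂ (zs′ , q , eq) = inj₂ (zs′ , q , cong (x ∷_) eq)

⊑-repW-++ : {A : Set} (r : ℕ) (w u : List A) {zs : List A} → zs ⊑ repW r w ++ u →
  (∃[ r′ ] ∃[ w′ ] r′ < r × w′ ⊑ w × zs ≡ repW r′ w ++ w′)
  ⊎ (∃[ u′ ] u′ ⊑ u × zs ≡ repW r w ++ u′)
⊑-repW-++ zero    w u p = inj₂ (_ , p , refl)
⊑-repW-++ (suc r) w u p
  with ⊑-++ w (≡.subst (_ ⊑_) (++-assoc w (repW r w) u) p)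
... | inj₁ q = inj₁ (0 , _ , s≤s z≤n , q , refl)
... | inj₂ (zs′ , q , refl) with ⊑-repW-++ r w u q
...   | inj₁ (r′ , w′ , r′<r , q′ , refl) =
          inj₁ (suc r′ , w′ , s≤s r′<r , q′ , sym (++-assoc w (repW r′ w) w′))
...   | inj₂ (u′ , q′ , refl) = inj₂ (u′ , q′ , sym (++-assoc w (repW r w) u′))

Linked-∷ʳ⁺ : {A : Set} {R : A → A → Set} {x : A} (xs : List A) →
             Linked R xs → All (λ y → R y x) xs → Linked R (xs ++ x ∷ [])
Linked-∷ʳ⁺ []           _         _        = [-]
Linked-∷ʳ⁺ (_ ∷ [])     _         (r ∷ []) = r ∷ [-]
Linked-∷ʳ⁺ (_ ∷ _ ∷ xs) (r₁ ∷ rs) (_ ∷ r)  = r₁ ∷ Linked-∷ʳ⁺ (_ ∷ xs) rs r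

Block : Set
Block = ℕ × ℕ

module Blocks {A : Set} (p1 p2 : List A) (q : ℕ → ℕ) where

  P : ℕ → List A
  P = Pw p1 p2 q

  Admissible : Block → Set
  Admissible b = 2 ≤ Σ.proj₁ b × Σ.proj₂ b ≤ q (Σ.proj₁ b ∸ 1)

  Ordered : Block → Block → Set
  Ordered b b′ = Σ.proj₁ b < Σ.proj₁ b′
               × (Σ.proj₂ b′ ≡ q (Σ.proj₁ b′ ∸ 1) → Σ.proj₁ b + 2 ≤ Σ.proj₁ b′)

  blockWord : Block → List A
  blockWord (k , r) = repW r (P k)

  -- As in blocksProd, the head of the list is the rightmost factor.
  blocksWord : List Block → List A
  blocksWord = foldr (λ b w → w ++ blockWord b) []

  record Decomposition (m : ℕ) (zs : List A) : Set where
    field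
      blocks     : List Block
      admissible : All Admissible blocks
      ordered    : Linked Ordered blocks
      below      : All (λ b → Σ.proj₁ b < m) blocks
      rest       : List A
      rest-⊑     : rest ⊑ p2
      split      : zs ≡ blocksWord blocks ++ rest

  open Decomposition

  noBlocks : ∀ {m zs} → zs ⊑ p2 → Decomposition m zs
  noBlocks {zs = zs} zs⊑p2 = record
    { blocks = [] ; admissible = [] ; ordered = [] ; below = []
    ; rest = zs ; rest-⊑ = zs⊑p2 ; split = refl }

  blocksWord-∷ʳ : ∀ bs b → blocksWord (bs ++ b ∷ []) ≡ blockWord b ++ blocksWord bs
  blocksWord-∷ʳ []       b = sym (++-identityʳ (blockWord b))
  blocksWord-∷ʳ (b′ ∷ bs) b = ≡.trans (cong (_++ blockWord b′) (blocksWord-∷ʳ bs b))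
                                      (++-assoc (blockWord b) (blocksWord bs) (blockWord b′))

  extend : ∀ {m zs} (δ : Decomposition m zs) (k r : ℕ) → m ≤ k → Admissible (k , r) →
           All (λ b → Ordered b (k , r)) (blocks δ) →
           Decomposition (suc k) (repW r (P k) ++ zs)
  extend {zs = zs} δ k r m≤k adm ord = record
    { blocks     = blocks δ ++ (k , r) ∷ []
    ; admissible = All.++⁺ (admissible δ) (adm ∷ [])
    ; ordered    = Linked-∷ʳ⁺ (blocks δ) (ordered δ) ord
    ; below      = All.++⁺ (All.map (λ b<m → m<n⇒m<1+n (<-≤-trans b<m m≤k)) (below δ)) (n<1+n k ∷ [])
    ; rest       = rest δ
    ; rest-⊑     = rest-⊑ δ
    ; split      = begin
        repW r (P k) ++ zs                                      ≡⟨ cong (repW r (P k) ++_) (split δ) ⟩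
        repW r (P k) ++ (blocksWord (blocks δ) ++ rest δ)       ≡⟨ sym (++-assoc (repW r (P k)) _ (rest δ)) ⟩
        (repW r (P k) ++ blocksWord (blocks δ)) ++ rest δ       ≡⟨ cong (_++ rest δ) (sym (blocksWord-∷ʳ (blocks δ) (k , r))) ⟩
        blocksWord (blocks δ ++ (k , r) ∷ []) ++ rest δ         ∎
    }
    where open ≡-Reasoning

  Decomposable : ℕ → Set
  Decomposable m = ∀ {zs} → zs ⊑ P m → Decomposition m zs

  decomposable-step : ∀ k → Decomposable (suc (suc k)) → Decomposable (suc k) →
                      Decomposable (suc (suc (suc k)))
  decomposable-step k dec₂ dec₁ zs⊑
    with ⊑-repW-++ (q (suc k)) (P (suc (suc k))) (P (suc k)) zs⊑
  ... | inj₁ (r , w′ , r<q , w′⊑ , refl) =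
    extend δ (suc (suc k)) r ≤-refl (s≤s (s≤s z≤n) , <⇒≤ r<q)
      (All.map (λ i<k → i<k , λ r≡q → ⊥-elim (<-irrefl r≡q r<q)) (below δ))
    where δ = dec₂ w′⊑
  ... | inj₂ (u′ , u′⊑ , refl) =
    extend δ (suc (suc k)) (q (suc k)) (n≤1+n (suc k)) (s≤s (s≤s z≤n) , ≤-refl)
      (All.map (λ i<k → m<n⇒m<1+n i<k , λ _ → +2-≤ i<k) (below δ))
    where
    δ = dec₁ u′⊑
    +2-≤ : ∀ {i} → i < suc k → i + 2 ≤ suc (suc k)
    +2-≤ {i} i<k rewrite +-comm i 2 = s≤s i<k

  decomposable : p1 ⊑ p2 → ∀ m → Decomposable m
  decomposable _     zero                []  = noBlocks []
  decomposable p1⊑p2 (suc zero)          zs⊑ = noBlocks (⊑-trans zs⊑ p1⊑p2)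
  decomposable _     (suc (suc zero))    zs⊑ = noBlocks zs⊑
  decomposable p1⊑p2 (suc (suc (suc k))) =
    decomposable-step k (decomposable p1⊑p2 (suc (suc k))) (decomposable p1⊑p2 (suc k))

evalW-blocksWord : ∀ {v} (ε α : Fin v → ℤ) (p1 p2 : List (Fin v)) (q : ℕ → ℕ) L →
  evalW ε α (Blocks.blocksWord p1 p2 q L) ≡ blocksProd (λ k → evalW ε α (Pw p1 p2 q k)) L
evalW-blocksWord ε α p1 p2 q []            = refl
evalW-blocksWord ε α p1 p2 q ((k , r) ∷ L) =
  ≡.trans (evalW-++ ε α (blocksWord L) (repW r (P k)))
          (cong₂ _⊗_ (evalW-blocksWord ε α p1 p2 q L) (evalW-repW ε α r (P k)))
  where open Blocks p1 p2 q

lemma2p7 : (v : ℕ) → 1 ≤ v →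
    (ε : Fin v → ℤ) → (∀ i → ε i ≡ 1ℤ ⊎ ε i ≡ -1ℤ) →
    (α : Fin v → ℤ) →
    (p1 p2 : List (Fin v)) →
    Cond (evalW ε α p1) → Cond (evalW ε α p2) →
    (∃[ s ] p2 ≡ p1 ++ s) →
    (q : ℕ → ℕ) → (∀ m → 1 ≤ m → 1 ≤ q m) →
    ∀ m n → n ≤ length (Pw p1 p2 q m) →
    ∃[ L ] ∃[ j ]
      ( All (λ b → 2 ≤ Σ.proj₁ b × Σ.proj₂ b ≤ q (Σ.proj₁ b ∸ 1)) L
      × Linked (λ b b′ → Σ.proj₁ b < Σ.proj₁ b′
                 × (Σ.proj₂ b′ ≡ q (Σ.proj₁ b′ ∸ 1) → Σ.proj₁ b + 2 ≤ Σ.proj₁ b′)) L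
      × j ≤ length p2
      × evalW ε α (take n (Pw p1 p2 q m))
          ≡ blocksProd (λ k → evalW ε α (Pw p1 p2 q k)) L ⊗ evalW ε α (take j p2) )
lemma2p7 _ _ ε _ α p1 p2 _ _ (s , p2≡p1++s) q _ m n _ =
  blocks δ , length (rest δ) , admissible δ , ordered δ , length-mono (rest-⊑ δ) , (begin
    evalW ε α (take n (P m))                                  ≡⟨ cong (evalW ε α) (split δ) ⟩
    evalW ε α (blocksWord (blocks δ) ++ rest δ)               ≡⟨ evalW-++ ε α (blocksWord (blocks δ)) (rest δ) ⟩
    evalW ε α (blocksWord (blocks δ)) ⊗ evalW ε α (rest δ)
      ≡⟨ cong₂ _⊗_ (evalW-blocksWord ε α p1 p2 q (blocks δ)) (cong (evalW ε α) (⊑⇒≡take (rest-⊑ δ))) ⟩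
    blocksProd (λ k → evalW ε α (P k)) (blocks δ) ⊗ evalW ε α (take (length (rest δ)) p2) ∎)
  where
  open Blocks p1 p2 q
  open Decomposition
  open ≡-Reasoning
  p1⊑p2 : p1 ⊑ p2
  p1⊑p2 = ∣ˡ-as-Prefix record { quotient = s ; equality = sym p2≡p1++s }
  δ : Decomposition m (take n (P m))
  δ = decomposable p1⊑p2 m (take-⊑ n (P m))
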